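{- Let $n \geq 0$ be an integer with $n \not\equiv 1 \pmod 3$. Then the Fibonacci-run graph $\mathcal{R}_n$ does not contain a Hamiltonian cycle.
   Context: A binary string is called run-constrained if every run (maximal block) of consecutive $1$s in it is immediately followed by a run of $0$s of strictly greater length. For $n \geq 1$, the Fibonacci-run graph $\mathcal{R}_n$ has vertex set $\{ w \in \{0,1\}^n : w00 \text{ is a run-constrained string of length } n+2\}$, and two vertices are adjacent iff they differ in exactly one coordinate; $\mathcal{R}_0$ is the one-vertex graph (whose vertex is the empty word). -}

module Defs where

open import Data.Bool using (Bool; true; false; if_then_else_)
open import Data.Bool.Properties using () renaming (_≟_ to _≟B_)
open import Data.Nat using (ℕ; zero; suc; _<_; _≤_; _+_)
open import Data.Product using (_×_; _,_)
open import Data.Unit using (⊤)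
open import Data.Empty using (⊥)
open import Data.List using (List; []; _∷_; _++_; length; _∷ʳ_)
open import Data.List.Relation.Unary.All using (All)
open import Data.List.Relation.Unary.Unique.Propositional using (Unique)
open import Data.List.Relation.Unary.Linked using (Linked)
open import Data.List.Membership.Propositional using (_∈_)
open import Data.Vec using (Vec; []; _∷_; toList)
open import Relation.Nullary.Decidable using (does)

-- Run-length encoding of a binary word: list of (bit, length of maximal run).
-- Consecutive entries always carry different bits.
private
  push : Bool → List (Bool × ℕ) → List (Bool × ℕ)
  push b [] = (b , 1) ∷ []
  push b ((c , k) ∷ r) =
    if does (b ≟B c) then (c , suc k) ∷ r else (b , 1) ∷ (c , k) ∷ r

runs : List Bool → List (Bool × ℕ)
runs [] = []
runs (b ∷ w) = push b (runs w)

RunsOK : List (Bool × ℕ) → Set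
RunsOK [] = ⊤
RunsOK ((false , k) ∷ r) = RunsOK r
RunsOK ((true , k) ∷ []) = ⊥
RunsOK ((true , k) ∷ (false , m) ∷ r) = (k < m) × RunsOK r
RunsOK ((true , k) ∷ (true , m) ∷ r) = ⊥

RunConstrained : List Bool → Set
RunConstrained w = RunsOK (runs w)

-- Vertices of the Fibonacci-run graph R_n: words w of length n with w00 run-constrained.
-- (For n = 0 this gives exactly the empty word, matching R_0.)
IsRunVertex : (n : ℕ) → Vec Bool n → Set
IsRunVertex n w = RunConstrained (toList w ++ false ∷ false ∷ [])

hamming : ∀ {n} → Vec Bool n → Vec Bool n → ℕ
hamming [] [] = 0
hamming (a ∷ u) (b ∷ v) = (if does (a ≟B b) then 0 else 1) + hamming u v

Adjacent : ∀ {n} → Vec Bool n → Vec Bool n → Set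
Adjacent u v = hamming u v ≡ 1
  where open import Relation.Binary.PropositionalEquality using (_≡_)

record HamiltonianCycle {V : Set} (IsV : V → Set) (Adj : V → V → Set) : Set where
  field
    start      : V
    rest       : List V
    atLeast3   : 3 ≤ length (start ∷ rest)
    areVerts   : All IsV (start ∷ rest)
    distinct   : Unique (start ∷ rest)
    spanning   : ∀ v → IsV v → v ∈ (start ∷ rest)
    adjacent   : Linked Adj ((start ∷ rest) ∷ʳ start)

RunGraphHamiltonianCycle : ℕ → Set
RunGraphHamiltonianCycle n = HamiltonianCycle (IsRunVertex n) (Adjacent {n})

-- A Hamiltonian cycle alternates between words of even and odd weight, so
-- it forces the signed count d n = Σ_{w ∈ R_n} (-1)^{|w|} to vanish.  Every
-- vertex of R_{n+2} is either 0w with w ∈ R_{n+1}, or is obtained from some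
-- w ∈ R_n by lengthening both the leading run of 1s of w00 and the run of 0s
-- after it by one, which changes the parity of the weight.  Hence
-- d (n+2) = d (n+1) - d n, so d (n+3) = - d n, and with d 0 = 1, d 1 = 0,
-- d 2 = -1 this gives d n = 0 exactly when n ≡ 1 (mod 3).

module Submission where

open import Defs
open import Data.Nat using (ℕ; _%_)
open import Relation.Binary.PropositionalEquality using (_≢_)
open import Relation.Nullary using (¬_)

open import Data.Bool using (Bool; true; false)
open import Data.Nat using (zero; suc; s≤s; z≤n) renaming (_+_ to _+ℕ_)
import Data.Nat.Properties as ℕ
open import Data.Nat.DivMod using ([m+kn]%n≡m%n)
open import Data.Integer using (ℤ; +_; -[1+_]; 0ℤ; -_; _+_; _-_)
open import Data.Integer.Tactic.RingSolver using (solve-∀)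
open import Data.Integer.Properties
  using (+-identityˡ; +-assoc; neg-distrib-+; neg-involutive; neg-injective; +-0-commutativeMonoid)
open import Data.Product using (∃; _×_; _,_)
open import Data.Empty using (⊥; ⊥-elim)
open import Data.Unit using (tt)
open import Data.List using (List; []; _∷_; _++_; map; foldr; _∷ʳ_)
open import Data.List.Properties using (map-∘; map-cong; map-++)
open import Data.Vec using (Vec; []; _∷_; toList)
import Data.Vec.Properties as Vec
open import Data.List.Relation.Unary.All using (All; []; _∷_; lookup)
import Data.List.Relation.Unary.All as All
import Data.List.Relation.Unary.All.Properties as All
open import Data.List.Relation.Unary.Any using (here; there)
open import Data.List.Relation.Unary.Linked using (Linked; [-]; _∷_)
open import Data.List.Relation.Unary.Unique.Propositional using (Unique; []; _∷_)
import Data.List.Relation.Unary.Unique.Propositional.Properties as Unique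
open import Data.List.Membership.Propositional using (_∈_)
open import Data.List.Membership.Propositional.Properties using (∈-map⁺; ∈-map⁻; ∈-++⁺ˡ; ∈-++⁺ʳ)
open import Data.List.Membership.Propositional.Properties.WithK using (unique∧set⇒bag)
open import Data.List.Relation.Binary.BagAndSetEquality using (∼bag⇒↭)
open import Data.List.Relation.Binary.Permutation.Propositional using (_↭_; ↭⇒↭ₛ)
import Data.List.Relation.Binary.Permutation.Propositional.Properties as Perm
open Perm using (∷↭∷ʳ)
open import Data.List.Relation.Binary.Permutation.Setoid.Properties using (foldr-commMonoid)
open import Algebra.Bundles using (CommutativeMonoid)
open import Function using (_∘_; mk⇔)
open import Relation.Binary.PropositionalEquality
  using (_≡_; refl; sym; trans; cong; cong₂; subst; module ≡-Reasoning)

pushRun : Bool → List (Bool × ℕ) → List (Bool × ℕ)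
pushRun b [] = (b , 1) ∷ []
pushRun true ((true , k) ∷ rs) = (true , suc k) ∷ rs
pushRun false ((false , k) ∷ rs) = (false , suc k) ∷ rs
pushRun true ((false , k) ∷ rs) = (true , 1) ∷ (false , k) ∷ rs
pushRun false ((true , k) ∷ rs) = (false , 1) ∷ (true , k) ∷ rs

runs-∷ : ∀ b w → runs (b ∷ w) ≡ pushRun b (runs w)
runs-∷ b w with runs w
... | [] = refl
runs-∷ true w | (true , k) ∷ rs = refl
runs-∷ true w | (false , k) ∷ rs = refl
runs-∷ false w | (true , k) ∷ rs = refl
runs-∷ false w | (false , k) ∷ rs = refl

RunsOK-pushRun-false⁻ : ∀ rs → RunsOK (pushRun false rs) → RunsOK rs
RunsOK-pushRun-false⁻ [] ok = tt
RunsOK-pushRun-false⁻ ((true , k) ∷ rs) ok = ok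
RunsOK-pushRun-false⁻ ((false , k) ∷ rs) ok = ok

RunsOK-pushRun-false⁺ : ∀ rs → RunsOK rs → RunsOK (pushRun false rs)
RunsOK-pushRun-false⁺ [] ok = tt
RunsOK-pushRun-false⁺ ((true , k) ∷ rs) ok = ok
RunsOK-pushRun-false⁺ ((false , k) ∷ rs) ok = ok

RunsOK-pushRun-true² : ∀ rs → RunsOK (pushRun true (pushRun true rs)) → RunsOK (pushRun true rs)
RunsOK-pushRun-true² [] ()
RunsOK-pushRun-true² ((false , k) ∷ rs) (k<m , ok) = ℕ.<⇒≤ k<m , ok
RunsOK-pushRun-true² ((true , k) ∷ []) ()
RunsOK-pushRun-true² ((true , k) ∷ (false , m) ∷ rs) (k<m , ok) = ℕ.<⇒≤ k<m , ok
RunsOK-pushRun-true² ((true , k) ∷ (true , m) ∷ rs) ()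

¬RunsOK-pushRun-101 : ∀ rs → ¬ RunsOK (pushRun true (pushRun false (pushRun true rs)))
¬RunsOK-pushRun-101 [] (s≤s () , _)
¬RunsOK-pushRun-101 ((true , k) ∷ rs) (s≤s () , _)
¬RunsOK-pushRun-101 ((false , k) ∷ rs) (s≤s () , _)

lengthenZeroRun : List (Bool × ℕ) → List (Bool × ℕ)
lengthenZeroRun [] = []
lengthenZeroRun ((false , m) ∷ rs) = (false , suc m) ∷ rs
lengthenZeroRun ((true , k) ∷ (false , m) ∷ rs) = (true , k) ∷ (false , suc m) ∷ rs
lengthenZeroRun ((true , k) ∷ []) = (true , k) ∷ []
lengthenZeroRun ((true , k) ∷ (true , m) ∷ rs) = (true , k) ∷ (true , m) ∷ rs

pushRun-true-lengthenZeroRun : ∀ rs → pushRun true (lengthenZeroRun rs) ≡ lengthenZeroRun (pushRun true rs)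
pushRun-true-lengthenZeroRun [] = refl
pushRun-true-lengthenZeroRun ((false , m) ∷ rs) = refl
pushRun-true-lengthenZeroRun ((true , k) ∷ []) = refl
pushRun-true-lengthenZeroRun ((true , k) ∷ (false , m) ∷ rs) = refl
pushRun-true-lengthenZeroRun ((true , k) ∷ (true , m) ∷ rs) = refl

pushRun-false² : ∀ rs → pushRun false (pushRun false rs) ≡ lengthenZeroRun (pushRun false rs)
pushRun-false² [] = refl
pushRun-false² ((false , m) ∷ rs) = refl
pushRun-false² ((true , k) ∷ rs) = refl

data PositiveHead : List (Bool × ℕ) → Set where
  positiveHead : ∀ b m rs → PositiveHead ((b , suc m) ∷ rs)

pushRun-PositiveHead : ∀ b rs → PositiveHead (pushRun b rs)
pushRun-PositiveHead b [] = positiveHead b 0 []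
pushRun-PositiveHead true ((true , k) ∷ rs) = positiveHead _ _ _
pushRun-PositiveHead false ((false , k) ∷ rs) = positiveHead _ _ _
pushRun-PositiveHead true ((false , k) ∷ rs) = positiveHead _ _ _
pushRun-PositiveHead false ((true , k) ∷ rs) = positiveHead _ _ _

RunsOK-pushRun-true-lengthen⁻ : ∀ {rs} → PositiveHead rs →
                                 RunsOK (pushRun true (lengthenZeroRun rs)) → RunsOK rs
RunsOK-pushRun-true-lengthen⁻ (positiveHead false m rs) (_ , ok) = ok
RunsOK-pushRun-true-lengthen⁻ (positiveHead true m []) ()
RunsOK-pushRun-true-lengthen⁻ (positiveHead true m ((false , j) ∷ rs)) (m<j , ok) = ℕ.≤-pred m<j , ok
RunsOK-pushRun-true-lengthen⁻ (positiveHead true m ((true , j) ∷ rs)) ()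

RunsOK-pushRun-true-lengthen⁺ : ∀ {rs} → PositiveHead rs →
                                 RunsOK rs → RunsOK (pushRun true (lengthenZeroRun rs))
RunsOK-pushRun-true-lengthen⁺ (positiveHead false m rs) ok = s≤s (s≤s z≤n) , ok
RunsOK-pushRun-true-lengthen⁺ (positiveHead true m []) ()
RunsOK-pushRun-true-lengthen⁺ (positiveHead true m ((false , j) ∷ rs)) (m<j , ok) = s≤s m<j , ok
RunsOK-pushRun-true-lengthen⁺ (positiveHead true m ((true , j) ∷ rs)) ()

Vertex : ∀ {n} → Vec Bool n → Set
Vertex {n} = IsRunVertex n

paddedRuns : ∀ {n} → Vec Bool n → List (Bool × ℕ)
paddedRuns w = runs (toList w ++ false ∷ false ∷ [])

paddedRuns-∷ : ∀ {n} b (w : Vec Bool n) → paddedRuns (b ∷ w) ≡ pushRun b (paddedRuns w)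
paddedRuns-∷ b w = runs-∷ b (toList w ++ false ∷ false ∷ [])

paddedRuns-PositiveHead : ∀ {n} (w : Vec Bool n) → PositiveHead (paddedRuns w)
paddedRuns-PositiveHead [] = positiveHead false 1 []
paddedRuns-PositiveHead (b ∷ w) =
  subst PositiveHead (sym (paddedRuns-∷ b w)) (pushRun-PositiveHead b (paddedRuns w))

insertZero : ∀ {n} → Vec Bool n → Vec Bool (suc n)
insertZero [] = false ∷ []
insertZero (true ∷ w) = true ∷ insertZero w
insertZero (false ∷ w) = false ∷ false ∷ w

-- Turns the leading runs 1ᵏ0ᵐ of w00 into 1ᵏ⁺¹0ᵐ⁺¹.
widen : ∀ {n} → Vec Bool n → Vec Bool (suc (suc n))
widen w = true ∷ insertZero w

insertZero-injective : ∀ {n} {u v : Vec Bool n} → insertZero u ≡ insertZero v → u ≡ v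
insertZero-injective {u = []} {[]} eq = refl
insertZero-injective {u = true ∷ u} {true ∷ v} eq = cong (true ∷_) (insertZero-injective (Vec.∷-injectiveʳ eq))
insertZero-injective {u = false ∷ u} {false ∷ v} refl = refl
insertZero-injective {u = true ∷ u} {false ∷ v} ()
insertZero-injective {u = false ∷ u} {true ∷ v} ()

paddedRuns-insertZero : ∀ {n} (w : Vec Bool n) → paddedRuns (insertZero w) ≡ lengthenZeroRun (paddedRuns w)
paddedRuns-insertZero [] = refl
paddedRuns-insertZero (true ∷ w) = begin
  paddedRuns (true ∷ insertZero w)              ≡⟨ paddedRuns-∷ true (insertZero w) ⟩
  pushRun true (paddedRuns (insertZero w))      ≡⟨ cong (pushRun true) (paddedRuns-insertZero w) ⟩
  pushRun true (lengthenZeroRun (paddedRuns w)) ≡⟨ pushRun-true-lengthenZeroRun (paddedRuns w) ⟩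
  lengthenZeroRun (pushRun true (paddedRuns w)) ≡⟨ cong lengthenZeroRun (paddedRuns-∷ true w) ⟨
  lengthenZeroRun (paddedRuns (true ∷ w))       ∎
  where open ≡-Reasoning
paddedRuns-insertZero (false ∷ w) = begin
  paddedRuns (false ∷ false ∷ w)                 ≡⟨ paddedRuns-∷ false (false ∷ w) ⟩
  pushRun false (paddedRuns (false ∷ w))         ≡⟨ cong (pushRun false) (paddedRuns-∷ false w) ⟩
  pushRun false (pushRun false (paddedRuns w))   ≡⟨ pushRun-false² (paddedRuns w) ⟩
  lengthenZeroRun (pushRun false (paddedRuns w)) ≡⟨ cong lengthenZeroRun (paddedRuns-∷ false w) ⟨
  lengthenZeroRun (paddedRuns (false ∷ w))       ∎
  where open ≡-Reasoning

paddedRuns-widen : ∀ {n} (w : Vec Bool n) → paddedRuns (widen w) ≡ pushRun true (lengthenZeroRun (paddedRuns w))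
paddedRuns-widen w = trans (paddedRuns-∷ true (insertZero w)) (cong (pushRun true) (paddedRuns-insertZero w))

Vertex-false⁻ : ∀ {n} (w : Vec Bool n) → Vertex (false ∷ w) → Vertex w
Vertex-false⁻ w v = RunsOK-pushRun-false⁻ (paddedRuns w) (subst RunsOK (paddedRuns-∷ false w) v)

Vertex-false⁺ : ∀ {n} (w : Vec Bool n) → Vertex w → Vertex (false ∷ w)
Vertex-false⁺ w v = subst RunsOK (sym (paddedRuns-∷ false w)) (RunsOK-pushRun-false⁺ (paddedRuns w) v)

Vertex-widen⁻ : ∀ {n} (w : Vec Bool n) → Vertex (widen w) → Vertex w
Vertex-widen⁻ w v =
  RunsOK-pushRun-true-lengthen⁻ (paddedRuns-PositiveHead w) (subst RunsOK (paddedRuns-widen w) v)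

Vertex-widen⁺ : ∀ {n} (w : Vec Bool n) → Vertex w → Vertex (widen w)
Vertex-widen⁺ w v =
  subst RunsOK (sym (paddedRuns-widen w)) (RunsOK-pushRun-true-lengthen⁺ (paddedRuns-PositiveHead w) v)

Vertex-true⇒insertZero : ∀ {n} (w : Vec Bool (suc n)) → Vertex (true ∷ w) → ∃ λ u → w ≡ insertZero u
Vertex-true⇒insertZero {zero} (false ∷ []) _ = [] , refl
Vertex-true⇒insertZero {zero} (true ∷ []) (s≤s (s≤s ()) , _)
Vertex-true⇒insertZero {suc n} (false ∷ false ∷ w) _ = false ∷ w , refl
Vertex-true⇒insertZero {suc n} (false ∷ true ∷ w) v =
  ⊥-elim (¬RunsOK-pushRun-101 (paddedRuns w) (subst RunsOK runs-101 v))
  where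
  runs-101 : paddedRuns (true ∷ false ∷ true ∷ w) ≡ pushRun true (pushRun false (pushRun true (paddedRuns w)))
  runs-101 = trans (paddedRuns-∷ true (false ∷ true ∷ w)) (cong (pushRun true)
               (trans (paddedRuns-∷ false (true ∷ w)) (cong (pushRun false) (paddedRuns-∷ true w))))
Vertex-true⇒insertZero {suc n} (true ∷ w) v
  with Vertex-true⇒insertZero w (subst RunsOK (sym (paddedRuns-∷ true w))
         (RunsOK-pushRun-true² (paddedRuns w) (subst RunsOK runs-11 v)))
  where
  runs-11 : paddedRuns (true ∷ true ∷ w) ≡ pushRun true (pushRun true (paddedRuns w))
  runs-11 = trans (paddedRuns-∷ true (true ∷ w)) (cong (pushRun true) (paddedRuns-∷ true w))
... | u , refl = true ∷ u , refl

vertices : (n : ℕ) → List (Vec Bool n)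
vertices zero = [] ∷ []
vertices (suc zero) = (false ∷ []) ∷ (true ∷ []) ∷ []
vertices (suc (suc n)) = map (false ∷_) (vertices (suc n)) ++ map widen (vertices n)

vertices-complete : ∀ n (w : Vec Bool n) → Vertex w → w ∈ vertices n
vertices-complete zero [] _ = here refl
vertices-complete (suc zero) (false ∷ []) _ = here refl
vertices-complete (suc zero) (true ∷ []) _ = there (here refl)
vertices-complete (suc (suc n)) (false ∷ w) v =
  ∈-++⁺ˡ (∈-map⁺ (false ∷_) (vertices-complete (suc n) w (Vertex-false⁻ w v)))
vertices-complete (suc (suc n)) (true ∷ w) v with Vertex-true⇒insertZero w v
... | u , refl = ∈-++⁺ʳ _ (∈-map⁺ widen (vertices-complete n u (Vertex-widen⁻ u v)))

vertices-sound : ∀ n → All Vertex (vertices n)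
vertices-sound zero = tt ∷ []
vertices-sound (suc zero) = tt ∷ (s≤s (s≤s z≤n) , tt) ∷ []
vertices-sound (suc (suc n)) =
  All.++⁺ (All.map⁺ (All.map (λ {w} → Vertex-false⁺ w) (vertices-sound (suc n))))
          (All.map⁺ (All.map (λ {w} → Vertex-widen⁺ w) (vertices-sound n)))

vertices-unique : ∀ n → Unique (vertices n)
vertices-unique zero = [] ∷ []
vertices-unique (suc zero) = ((λ ()) ∷ []) ∷ [] ∷ []
vertices-unique (suc (suc n)) =
  Unique.++⁺ (Unique.map⁺ Vec.∷-injectiveʳ (vertices-unique (suc n)))
             (Unique.map⁺ (insertZero-injective ∘ Vec.∷-injectiveʳ) (vertices-unique n))
             disjoint
  where
  disjoint : ∀ {w} → w ∈ map (false ∷_) (vertices (suc n)) × w ∈ map widen (vertices n) → ⊥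
  disjoint (w∈₀ , w∈₁) with ∈-map⁻ (false ∷_) w∈₀ | ∈-map⁻ widen w∈₁
  ... | _ , _ , refl | _ , _ , ()

sumℤ : List ℤ → ℤ
sumℤ = foldr _+_ 0ℤ

sumℤ-++ : ∀ xs ys → sumℤ (xs ++ ys) ≡ sumℤ xs + sumℤ ys
sumℤ-++ [] ys = sym (+-identityˡ (sumℤ ys))
sumℤ-++ (x ∷ xs) ys = trans (cong (λ s → x + s) (sumℤ-++ xs ys)) (sym (+-assoc x (sumℤ xs) (sumℤ ys)))

sumℤ-neg : ∀ xs → sumℤ (map -_ xs) ≡ - sumℤ xs
sumℤ-neg [] = refl
sumℤ-neg (x ∷ xs) = trans (cong (λ s → - x + s) (sumℤ-neg xs)) (sym (neg-distrib-+ x (sumℤ xs)))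

sumℤ-↭ : ∀ {xs ys} → xs ↭ ys → sumℤ xs ≡ sumℤ ys
sumℤ-↭ p = foldr-commMonoid M.setoid M.isCommutativeMonoid (↭⇒↭ₛ p)
  where module M = CommutativeMonoid +-0-commutativeMonoid

i≡-i⇒i≡0 : ∀ {i} → i ≡ - i → i ≡ 0ℤ
i≡-i⇒i≡0 {+ zero} _ = refl
i≡-i⇒i≡0 {+ suc n} ()
i≡-i⇒i≡0 { -[1+ n ]} ()

module _ {A : Set} {_~_ : A → A → Set} (σ : A → ℤ) (σ-flip : ∀ x y → x ~ y → σ y ≡ - σ x) where

  walk-map-σ : ∀ x xs y → Linked _~_ (x ∷ xs ∷ʳ y) → map σ (xs ∷ʳ y) ≡ map (-_ ∘ σ) (x ∷ xs)
  walk-map-σ x [] y (x~y ∷ [-]) = cong (_∷ []) (σ-flip x y x~y)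
  walk-map-σ x (z ∷ zs) y (x~z ∷ walk) = cong₂ _∷_ (σ-flip x z x~z) (walk-map-σ z zs y walk)

  -- Shifting a closed walk by one step permutes it but negates every σ-value.
  closedWalk-sumℤ≡0 : ∀ x xs → Linked _~_ (x ∷ xs ∷ʳ x) → sumℤ (map σ (x ∷ xs)) ≡ 0ℤ
  closedWalk-sumℤ≡0 x xs walk = i≡-i⇒i≡0 (begin
    sumℤ (map σ (x ∷ xs))            ≡⟨ sumℤ-↭ (Perm.map⁺ σ (∷↭∷ʳ x xs)) ⟩
    sumℤ (map σ (xs ∷ʳ x))           ≡⟨ cong sumℤ (walk-map-σ x xs x walk) ⟩
    sumℤ (map (-_ ∘ σ) (x ∷ xs))     ≡⟨ cong sumℤ (map-∘ {g = -_} {f = σ} (x ∷ xs)) ⟩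
    sumℤ (map -_ (map σ (x ∷ xs)))   ≡⟨ sumℤ-neg (map σ (x ∷ xs)) ⟩
    - sumℤ (map σ (x ∷ xs))          ∎)
    where open ≡-Reasoning

sign : ∀ {n} → Vec Bool n → ℤ
sign [] = + 1
sign (true ∷ w) = - sign w
sign (false ∷ w) = sign w

sign-insertZero : ∀ {n} (w : Vec Bool n) → sign (insertZero w) ≡ sign w
sign-insertZero [] = refl
sign-insertZero (true ∷ w) = cong -_ (sign-insertZero w)
sign-insertZero (false ∷ w) = refl

sign-widen : ∀ {n} (w : Vec Bool n) → sign (widen w) ≡ - sign w
sign-widen w = cong -_ (sign-insertZero w)

hamming≡0⇒≡ : ∀ {n} (u v : Vec Bool n) → hamming u v ≡ 0 → u ≡ v
hamming≡0⇒≡ [] [] _ = refl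
hamming≡0⇒≡ (true ∷ u) (true ∷ v) eq = cong (true ∷_) (hamming≡0⇒≡ u v eq)
hamming≡0⇒≡ (false ∷ u) (false ∷ v) eq = cong (false ∷_) (hamming≡0⇒≡ u v eq)
hamming≡0⇒≡ (true ∷ u) (false ∷ v) ()
hamming≡0⇒≡ (false ∷ u) (true ∷ v) ()

Adjacent⇒sign-flip : ∀ {n} (u v : Vec Bool n) → Adjacent u v → sign v ≡ - sign u
Adjacent⇒sign-flip [] [] ()
Adjacent⇒sign-flip (true ∷ u) (true ∷ v) adj = cong -_ (Adjacent⇒sign-flip u v adj)
Adjacent⇒sign-flip (false ∷ u) (false ∷ v) adj = Adjacent⇒sign-flip u v adj
Adjacent⇒sign-flip (true ∷ u) (false ∷ v) adj
  rewrite hamming≡0⇒≡ u v (ℕ.suc-injective adj) = sym (neg-involutive (sign v))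
Adjacent⇒sign-flip (false ∷ u) (true ∷ v) adj
  rewrite hamming≡0⇒≡ u v (ℕ.suc-injective adj) = refl

signedCount : ℕ → ℤ
signedCount n = sumℤ (map sign (vertices n))

signedCount-rec : ∀ n → signedCount (suc (suc n)) ≡ signedCount (suc n) - signedCount n
signedCount-rec n = begin
  sumℤ (map sign (map (false ∷_) V₁ ++ map widen V₀))
    ≡⟨ cong sumℤ (map-++ sign (map (false ∷_) V₁) (map widen V₀)) ⟩
  sumℤ (map sign (map (false ∷_) V₁) ++ map sign (map widen V₀))
    ≡⟨ sumℤ-++ (map sign (map (false ∷_) V₁)) (map sign (map widen V₀)) ⟩
  sumℤ (map sign (map (false ∷_) V₁)) + sumℤ (map sign (map widen V₀))
    ≡⟨ cong₂ _+_ (cong sumℤ (sym (map-∘ V₁))) (cong sumℤ signs-widened) ⟩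
  sumℤ (map sign V₁) + sumℤ (map -_ (map sign V₀))
    ≡⟨ cong (λ s → sumℤ (map sign V₁) + s) (sumℤ-neg (map sign V₀)) ⟩
  signedCount (suc n) - signedCount n ∎
  where
  open ≡-Reasoning
  V₁ : List (Vec Bool (suc n))
  V₁ = vertices (suc n)
  V₀ : List (Vec Bool n)
  V₀ = vertices n
  signs-widened : map sign (map widen V₀) ≡ map -_ (map sign V₀)
  signs-widened = begin
    map sign (map widen V₀)   ≡⟨ map-∘ V₀ ⟨
    map (sign ∘ widen) V₀     ≡⟨ map-cong sign-widen V₀ ⟩
    map (-_ ∘ sign) V₀        ≡⟨ map-∘ V₀ ⟩
    map -_ (map sign V₀)      ∎

signedCount-+3 : ∀ n → signedCount (suc (suc (suc n))) ≡ - signedCount n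
signedCount-+3 n = begin
  signedCount (suc (suc (suc n)))               ≡⟨ signedCount-rec (suc n) ⟩
  signedCount (suc (suc n)) - a                 ≡⟨ cong (_- a) (signedCount-rec n) ⟩
  (a - b) - a                                   ≡⟨ cancel a b ⟩
  - b                                           ∎
  where
  open ≡-Reasoning
  a b : ℤ
  a = signedCount (suc n)
  b = signedCount n
  cancel : ∀ a b → (a - b) - a ≡ - b
  cancel = solve-∀

signedCount≡0⇒≡1mod3 : ∀ n → signedCount n ≡ 0ℤ → n % 3 ≡ 1
signedCount≡0⇒≡1mod3 0 ()
signedCount≡0⇒≡1mod3 1 _ = refl
signedCount≡0⇒≡1mod3 2 ()
signedCount≡0⇒≡1mod3 (suc (suc (suc n))) eq = begin
  suc (suc (suc n)) % 3 ≡⟨ cong (_% 3) (ℕ.+-comm 3 n) ⟩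
  (n +ℕ 3) % 3          ≡⟨ [m+kn]%n≡m%n n 1 3 ⟩
  n % 3                 ≡⟨ signedCount≡0⇒≡1mod3 n (neg-injective (trans (sym (signedCount-+3 n)) eq)) ⟩
  1                     ∎
  where open ≡-Reasoning

lemma9p1 : (n : ℕ) → n % 3 ≢ 1 → ¬ RunGraphHamiltonianCycle n
lemma9p1 n n≢1 H = n≢1 (signedCount≡0⇒≡1mod3 n (begin
  signedCount n                    ≡⟨ sumℤ-↭ (Perm.map⁺ sign vertices↭cycle) ⟩
  sumℤ (map sign (start ∷ rest))   ≡⟨ closedWalk-sumℤ≡0 sign Adjacent⇒sign-flip start rest adjacent ⟩
  0ℤ                               ∎))
  where
  open ≡-Reasoning
  open HamiltonianCycle H
  vertices↭cycle : vertices n ↭ start ∷ rest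
  vertices↭cycle = ∼bag⇒↭ (unique∧set⇒bag (vertices-unique n) distinct
    (mk⇔ (λ w∈ → spanning _ (lookup (vertices-sound n) w∈))
         (λ w∈ → vertices-complete n _ (lookup areVerts w∈))))
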